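{- Let $k\ge2$ and $\sigma\in\{+,-\}^k$ be arbitrary, and let $\pi\in\mathcal S_n$ be such that $\hat\pi\in\mathcal C^\sigma$. Take any $\sigma$-segmentation $0=e_0\le\dots\le e_k=n$ of $\hat\pi$, let $s_1\dots s_n$ be the $\pi$-monotone word induced by it, and let $s=(s_1\dots s_n)^\infty$. If $1\le i,j\le n$ satisfy $\pi_i<\pi_j$, then either $s_{[i,\infty)}=s_{[j,\infty)}$ or $s_{[i,\infty)}\prec_\sigma s_{[j,\infty)}$. In particular, if $s_1\dots s_n$ is primitive, then $\Pi_\sigma(s)=\pi$.
   Context: Let $T^-_\sigma=\{t:\sigma_t=-\}$. Let $\mathcal W_k$ be the set of infinite words $s=s_1s_2\dots$ over $\{0,\dots,k-1\}$, $s_{[i,\infty)}=s_is_{i+1}\dots$. The order $\prec_\sigma$: for $s\ne t$, with $j$ the first index where $s_j\neq t_j$ and $c=|\{i<j:s_i\in T^-_\sigma\}|$, $s\prec_\sigma t$ iff ($c$ even and $s_j<t_j$) or ($c$ odd and $s_j>t_j$). A finite word is primitive if it is not a concatenation of two or more copies of a shorter word. For primitive $s_1\dots s_n$ and $s=(s_1\dots s_n)^\infty$, $\Pi_\sigma(s)\in\mathcal S_n$ is the permutation with $\Pi_\sigma(s)_i<\Pi_\sigma(s)_j$ iff $s_{[i,\infty)}\prec_\sigma s_{[j,\infty)}$. For $\pi\in\mathcal S_n$, $\hat\pi$ is the cyclic permutation $(\pi_1,\dots,\pi_n)$ in cycle notation, i.e. $\hat\pi_{\pi_i}=\pi_{i+1}$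 with $\pi_{n+1}=\pi_1$. A $\sigma$-segmentation of $\tau\in\mathcal S_n$ is $0=e_0\le e_1\le\dots\le e_k=n$ such that each $\tau_{e_t+1}\dots\tau_{e_{t+1}}$ is increasing if $\sigma_t=+$ and decreasing if $\sigma_t=-$. $\mathcal C^\sigma$ is the set of cyclic permutations (single cycles) admitting a $\sigma$-segmentation. The $\pi$-monotone word induced by $e_0,\dots,e_k$ is the word $s_1\dots s_n$ with $s_i=t$ whenever $e_t<\pi_i\le e_{t+1}$. -}

module Defs where

open import Data.Nat using (ℕ; zero; suc; _+_; _*_; _≤_; _<_; NonZero)
open import Data.Nat.DivMod using (_mod_; _%_)
open import Data.Fin using (Fin; toℕ; inject₁; fromℕ) renaming (zero to fzero; suc to fsuc)
open import Data.Fin.Permutation using (Permutation′; _⟨$⟩ʳ_; _⟨$⟩ˡ_)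
open import Data.List using (List; length; concat; replicate; tabulate)
open import Data.Product using (Σ; _×_; ∃; ∃-syntax)
open import Data.Sum using (_⊎_)
open import Relation.Binary.PropositionalEquality using (_≡_)
open import Relation.Nullary using (¬_)

data Sign : Set where
  plus minus : Sign

Word : ℕ → Set
Word k = ℕ → Fin k

-- suffix s_[i,∞)  (0-based: position i)
suffix : ∀ {k} → Word k → ℕ → Word k
suffix s i m = s (i + m)

_≐_ : ∀ {k} → Word k → Word k → Set
s ≐ t = ∀ m → s m ≡ t m

negInd : Sign → ℕ
negInd plus  = 0
negInd minus = 1

countNeg : ∀ {k} → (Fin k → Sign) → Word k → ℕ → ℕ
countNeg σ s zero    = 0
countNeg σ s (suc j) = countNeg σ s j + negInd (σ (s j))

_≺[_]_ : ∀ {k} → Word k → (Fin k → Sign) → Word k → Set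
s ≺[ σ ] t = ∃[ j ] ((∀ m → m < j → s m ≡ t m) ×
   ((countNeg σ s j % 2 ≡ 0 × toℕ (s j) < toℕ (t j)) ⊎
    (countNeg σ s j % 2 ≡ 1 × toℕ (t j) < toℕ (s j))))

-- periodic word (s_1 … s_n)^∞   (0-based)
periodic : ∀ {k n} .{{_ : NonZero n}} → (Fin n → Fin k) → Word k
periodic {n = n} s m = s (m mod n)

Primitive : ∀ {A : Set} {n} → (Fin n → A) → Set
Primitive {A} {n} s = ¬ (Σ (List A) λ u → Σ ℕ λ r →
   2 ≤ r × length u < n × tabulate s ≡ concat (replicate r u))

next : ∀ {n} .{{_ : NonZero n}} → Fin n → Fin n
next {n} i = suc (toℕ i) mod n

-- π̂ = (π_1, …, π_n) in cycle notation: π̂(π_i) = π_{i+1}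
hat : ∀ {n} .{{_ : NonZero n}} → Permutation′ n → Fin n → Fin n
hat π x = π ⟨$⟩ʳ next (π ⟨$⟩ˡ x)

Mono : Sign → ℕ → ℕ → Set
Mono plus  a b = a < b
Mono minus a b = b < a

-- e_0,…,e_k is a σ-segmentation of τ (given in one-line notation τ : Fin n → Fin n).
-- Block t (0-based) consists of the 0-based positions p with e_t ≤ p < e_{t+1}.
IsSegmentation : ∀ {k n} → (Fin k → Sign) → (Fin (suc k) → ℕ) → (Fin n → Fin n) → Set
IsSegmentation {k} {n} σ e τ =
  (e fzero ≡ 0) × (e (fromℕ k) ≡ n) ×
  (∀ (t : Fin k) → e (inject₁ t) ≤ e (fsuc t)) ×
  (∀ (t : Fin k) (p q : Fin n) → e (inject₁ t) ≤ toℕ p → toℕ p < toℕ q →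
       toℕ q < e (fsuc t) → Mono (σ t) (toℕ (τ p)) (toℕ (τ q)))

-- s is the π-monotone word induced by e: s_i = t whenever e_t < π_i ≤ e_{t+1}
-- (1-based values), i.e. e_t ≤ toℕ (π i) < e_{t+1} with 0-based values.
IsInducedWord : ∀ {k n} → Permutation′ n → (Fin (suc k) → ℕ) → (Fin n → Fin k) → Set
IsInducedWord π e s = ∀ i →
  e (inject₁ (s i)) ≤ toℕ (π ⟨$⟩ʳ i) × toℕ (π ⟨$⟩ʳ i) < e (fsuc (s i))

IsPattern : ∀ {k n} → (Fin k → Sign) → Word k → Permutation′ n → Set
IsPattern σ s ρ = ∀ i j →
  (toℕ (ρ ⟨$⟩ʳ i) < toℕ (ρ ⟨$⟩ʳ j) → suffix s (toℕ i) ≺[ σ ] suffix s (toℕ j)) ×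
  (suffix s (toℕ i) ≺[ σ ] suffix s (toℕ j) → toℕ (ρ ⟨$⟩ʳ i) < toℕ (ρ ⟨$⟩ʳ j))

-- Compare the suffixes at positions i and j letter by letter. While they agree,
-- the current positions keep distinct π-values, and stepping both by one applies
-- π̂, which maps each block monotonically: it preserves their order on a block of
-- sign + and reverses it on a block of sign −. So the order of the π-values is
-- always the one prescribed by the parity of the number of − letters read so far.
-- At the first disagreement the letters are ordered like the π-values, because the
-- induced word is monotone in π, and that is exactly s_[i,∞) ≺σ s_[j,∞). If there
-- is no disagreement within n steps the suffixes coincide. For a primitive word
-- this forces i = j: equal suffixes at i < j make j − i a period, hence so is the
-- proper divisor gcd(n, j − i) of n, and the word is a power of its prefix.
module Submission where

open import Defs
open import Data.Nat using (ℕ; zero; suc; _+_; _*_; _∸_; _≤_; _<_; NonZero; z≤n; s≤s; s≤s⁻¹; >-nonZero)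
open import Data.Nat.Properties
open import Data.Nat.DivMod using (_%_; _mod_; _/_; m%n<n; m≡m%n+[m/n]*n; [m+n]%n≡m%n; %-distribˡ-+; m%n%n≡m%n; m<n⇒m%n≡m)
open import Data.Nat.Divisibility using (_∣_; divides)
open import Data.Nat.GCD using (gcd; gcd-GCD; gcd[m,n]∣m; gcd[m,n]≤n; module Bézout)
open import Data.Nat.Tactic.RingSolver using (solve-∀)
open import Data.Fin using (Fin; toℕ; inject₁) renaming (zero to fzero; suc to fsuc)
open import Data.Fin.Properties using (toℕ-injective; toℕ-fromℕ<; fromℕ<-cong; toℕ<n; toℕ-inject₁) renaming (_≟_ to _≟ᶠ_)
open import Data.Fin.Permutation using (Permutation′; _⟨$⟩ʳ_; _⟨$⟩ˡ_; inverseˡ)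
open import Data.List using (_∷_; _++_; length; concat; replicate; tabulate; applyUpTo)
open import Data.List.Properties using (length-applyUpTo)
open import Data.Product using (_×_; _,_; proj₁; proj₂)
open import Data.Sum using (_⊎_; inj₁; inj₂)
open import Data.Empty using (⊥-elim)
open import Function using (_∘_)
open import Relation.Nullary using (¬_; yes; no)
open import Relation.Binary using (tri<; tri≈; tri>)
open import Relation.Binary.PropositionalEquality

Oriented : ℕ → ℕ → ℕ → Set
Oriented c x y = (c % 2 ≡ 0 × x < y) ⊎ (c % 2 ≡ 1 × y < x)

oriented-irrefl : ∀ c {x} → ¬ Oriented c x x
oriented-irrefl _ (inj₁ (_ , x<x)) = <-irrefl refl x<x
oriented-irrefl _ (inj₂ (_ , x<x)) = <-irrefl refl x<x

oriented-asym : ∀ c {x y} → Oriented c x y → ¬ Oriented c y x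
oriented-asym _ (inj₁ (_ , x<y)) (inj₁ (_ , y<x)) = <-asym x<y y<x
oriented-asym _ (inj₁ (even , _)) (inj₂ (odd , _)) with () ← trans (sym even) odd
oriented-asym _ (inj₂ (odd , _)) (inj₁ (even , _)) with () ← trans (sym odd) even
oriented-asym _ (inj₂ (_ , y<x)) (inj₂ (_ , x<y)) = <-asym x<y y<x

even⇒odd-suc : ∀ c → c % 2 ≡ 0 → (c + 1) % 2 ≡ 1
even⇒odd-suc c even = trans (%-distribˡ-+ c 1 2) (cong (λ r → (r + 1) % 2) even)

odd⇒even-suc : ∀ c → c % 2 ≡ 1 → (c + 1) % 2 ≡ 0
odd⇒even-suc c odd = trans (%-distribˡ-+ c 1 2) (cong (λ r → (r + 1) % 2) odd)

oriented-step : ∀ c sg {x y x′ y′} → Oriented c x y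
  → (x < y → Mono sg x′ y′) → (y < x → Mono sg y′ x′) → Oriented (c + negInd sg) x′ y′
oriented-step c plus  (inj₁ (even , x<y)) up down rewrite +-identityʳ c = inj₁ (even , up x<y)
oriented-step c plus  (inj₂ (odd , y<x))  up down rewrite +-identityʳ c = inj₂ (odd , down y<x)
oriented-step c minus (inj₁ (even , x<y)) up down = inj₂ (even⇒odd-suc c even , up x<y)
oriented-step c minus (inj₂ (odd , y<x))  up down = inj₁ (odd⇒even-suc c odd , down y<x)

countNeg-cong : ∀ {k} (σ : Fin k → Sign) {a b : Word k} j
  → (∀ m → m < j → a m ≡ b m) → countNeg σ a j ≡ countNeg σ b j
countNeg-cong σ zero    agree = refl
countNeg-cong σ (suc j) agree = cong₂ _+_
  (countNeg-cong σ j (λ m m<j → agree m (m<n⇒m<1+n m<j)))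
  (cong (negInd ∘ σ) (agree j (n<1+n j)))

module _ {k : ℕ} {σ : Fin k → Sign} where

  ≺-irrefl : ∀ {a b : Word k} → a ≐ b → ¬ (a ≺[ σ ] b)
  ≺-irrefl {a} a≐b (j , _ , oriented) = oriented-irrefl (countNeg σ a j)
    (subst (Oriented (countNeg σ a j) (toℕ (a j)) ∘ toℕ) (sym (a≐b j)) oriented)

  ≺-asym : ∀ {a b : Word k} → a ≺[ σ ] b → ¬ (b ≺[ σ ] a)
  ≺-asym {a} {b} (j₁ , agree₁ , o₁) (j₂ , agree₂ , o₂) with <-cmp j₁ j₂
  ... | tri< j₁<j₂ _ _ = oriented-irrefl (countNeg σ a j₁)
    (subst (Oriented (countNeg σ a j₁) (toℕ (a j₁)) ∘ toℕ) (agree₂ j₁ j₁<j₂) o₁)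
  ... | tri> _ _ j₂<j₁ = oriented-irrefl (countNeg σ b j₂)
    (subst (Oriented (countNeg σ b j₂) (toℕ (b j₂)) ∘ toℕ) (agree₁ j₂ j₂<j₁) o₂)
  ... | tri≈ _ refl _ = oriented-asym (countNeg σ a j₁) o₁
    (subst (λ c → Oriented c (toℕ (b j₁)) (toℕ (a j₁))) (countNeg-cong σ j₁ agree₂) o₂)

Period : {A : Set} → (ℕ → A) → ℕ → Set
Period f p = ∀ m → f (p + m) ≡ f m

module _ {A : Set} {f : ℕ → A} where

  period-* : ∀ {p} → Period f p → ∀ q → Period f (q * p)
  period-* per zero    m = refl
  period-* {p} per (suc q) m = trans (cong f (+-assoc p (q * p) m)) (trans (per (q * p + m)) (period-* per q m))

  period-cancel : ∀ {a b g} → Period f a → Period f b → g + a ≡ b → Period f g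
  period-cancel {a} {b} {g} perᵃ perᵇ g+a≡b m = begin
    f (g + m)       ≡⟨ sym (perᵃ (g + m)) ⟩
    f (a + (g + m)) ≡⟨ cong f (trans (sym (+-assoc a g m)) (cong (_+ m) (+-comm a g))) ⟩
    f (g + a + m)   ≡⟨ cong (λ x → f (x + m)) g+a≡b ⟩
    f (b + m)       ≡⟨ perᵇ m ⟩
    f m             ∎
    where open ≡-Reasoning

  period-gcd : ∀ {p q} → Period f p → Period f q → Period f (gcd p q)
  period-gcd {p} {q} perᵖ perᑫ with Bézout.identity (gcd-GCD p q)
  ... | Bézout.+- x y eq = period-cancel (period-* perᑫ y) (period-* perᵖ x) eq
  ... | Bézout.-+ x y eq = period-cancel (period-* perᵖ x) (period-* perᑫ y) eq

  period-% : ∀ {p} .{{_ : NonZero p}} → Period f p → ∀ m → f m ≡ f (m % p)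
  period-% {p} per m = trans (cong f m≡[m/p]*p+m%p) (period-* per (m / p) (m % p))
    where
    m≡[m/p]*p+m%p : m ≡ m / p * p + m % p
    m≡[m/p]*p+m%p = trans (m≡m%n+[m/n]*n m p) (+-comm (m % p) _)

  equal-shifts⇒period : ∀ {p i j d} → Period f p → i ≤ p → i + d ≡ j
    → (∀ m → f (i + m) ≡ f (j + m)) → Period f d
  equal-shifts⇒period {p} {i} {j} {d} per i≤p i+d≡j shifts m = begin
    f (d + m)           ≡⟨ sym (per (d + m)) ⟩
    f (p + (d + m))     ≡⟨ cong (λ x → f (x + (d + m))) (sym i+r≡p) ⟩
    f (i + r + (d + m)) ≡⟨ cong f (swap-middle i r d m) ⟩
    f (i + d + (r + m)) ≡⟨ cong (λ x → f (x + (r + m))) i+d≡j ⟩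
    f (j + (r + m))     ≡⟨ sym (shifts (r + m)) ⟩
    f (i + (r + m))     ≡⟨ cong f (sym (+-assoc i r m)) ⟩
    f (i + r + m)       ≡⟨ cong (λ x → f (x + m)) i+r≡p ⟩
    f (p + m)           ≡⟨ per m ⟩
    f m                 ∎
    where
    open ≡-Reasoning
    swap-middle : ∀ a b c d → a + b + (c + d) ≡ a + c + (b + d)
    swap-middle = solve-∀
    r : ℕ
    r = p ∸ i
    i+r≡p : i + r ≡ p
    i+r≡p = m+[n∸m]≡n i≤p

≐-from-prefix : ∀ {k n} .{{_ : NonZero n}} {a b : Word k} → Period a n → Period b n
  → (∀ l → l < n → a l ≡ b l) → a ≐ b
≐-from-prefix {n = n} perᵃ perᵇ prefix m =
  trans (period-% perᵃ m) (trans (prefix (m % n) (m%n<n m n)) (sym (period-% perᵇ m)))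

suffix-period : ∀ {k p} {w : Word k} → Period w p → ∀ i → Period (suffix w i) p
suffix-period {p = p} {w} per i m =
  trans (cong w (trans (sym (+-assoc i p m)) (trans (cong (_+ m) (+-comm i p)) (+-assoc p i m)))) (per (i + m))

module _ {A : Set} where

  applyUpTo-cong : ∀ {f g : ℕ → A} → (∀ m → f m ≡ g m) → ∀ n → applyUpTo f n ≡ applyUpTo g n
  applyUpTo-cong f≗g zero    = refl
  applyUpTo-cong f≗g (suc n) = cong₂ _∷_ (f≗g 0) (applyUpTo-cong (f≗g ∘ suc) n)

  applyUpTo-+ : ∀ (f : ℕ → A) m n
    → applyUpTo f (m + n) ≡ applyUpTo f m ++ applyUpTo (λ l → f (m + l)) n
  applyUpTo-+ f zero    n = refl
  applyUpTo-+ f (suc m) n = cong (f 0 ∷_) (applyUpTo-+ (f ∘ suc) m n)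

  applyUpTo-period : ∀ {f : ℕ → A} {p} → Period f p
    → ∀ r → applyUpTo f (r * p) ≡ concat (replicate r (applyUpTo f p))
  applyUpTo-period         per zero    = refl
  applyUpTo-period {f} {p} per (suc r) = begin
    applyUpTo f (p + r * p)                                   ≡⟨ applyUpTo-+ f p (r * p) ⟩
    applyUpTo f p ++ applyUpTo (λ l → f (p + l)) (r * p)       ≡⟨ cong (applyUpTo f p ++_) (applyUpTo-cong per (r * p)) ⟩
    applyUpTo f p ++ applyUpTo f (r * p)                       ≡⟨ cong (applyUpTo f p ++_) (applyUpTo-period per r) ⟩
    applyUpTo f p ++ concat (replicate r (applyUpTo f p))      ∎
    where open ≡-Reasoning

  tabulate-applyUpTo : ∀ {n} (f : Fin n → A) (g : ℕ → A)
    → (∀ x → f x ≡ g (toℕ x)) → tabulate f ≡ applyUpTo g n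
  tabulate-applyUpTo {zero}  f g f≗g = refl
  tabulate-applyUpTo {suc n} f g f≗g =
    cong₂ _∷_ (f≗g fzero) (tabulate-applyUpTo (f ∘ fsuc) (g ∘ suc) (f≗g ∘ fsuc))

module _ {n : ℕ} .{{_ : NonZero n}} where

  toℕ-mod : ∀ m → toℕ (m mod n) ≡ m % n
  toℕ-mod m = toℕ-fromℕ< (m%n<n m n)

  mod-cong : ∀ {a b} → a % n ≡ b % n → a mod n ≡ b mod n
  mod-cong eq = fromℕ<-cong _ _ eq (m%n<n _ n) (m%n<n _ n)

  toℕ-mod-id : ∀ (x : Fin n) → toℕ x mod n ≡ x
  toℕ-mod-id x = toℕ-injective (trans (toℕ-mod (toℕ x)) (m<n⇒m%n≡m (toℕ<n x)))

  next-mod : ∀ x → next (x mod n) ≡ suc x mod n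
  next-mod x = mod-cong (begin
    (1 + toℕ (x mod n)) % n     ≡⟨ cong (λ r → (1 + r) % n) (toℕ-mod x) ⟩
    (1 + x % n) % n             ≡⟨ %-distribˡ-+ 1 (x % n) n ⟩
    (1 % n + x % n % n) % n     ≡⟨ cong (λ r → (1 % n + r) % n) (m%n%n≡m%n x n) ⟩
    (1 % n + x % n) % n         ≡⟨ sym (%-distribˡ-+ 1 x n) ⟩
    (1 + x) % n                 ∎)
    where open ≡-Reasoning

  next-shift : ∀ x m → next ((x + m) mod n) ≡ (x + suc m) mod n
  next-shift x m = trans (next-mod (x + m)) (cong (_mod n) (sym (+-suc x m)))

  module _ {k : ℕ} (s : Fin n → Fin k) where

    periodic-period : Period (periodic s) n
    periodic-period m = cong s (mod-cong (trans (cong (_% n) (+-comm n m)) ([m+n]%n≡m%n m n)))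

    proper-period⇒¬primitive : ∀ {g} → Period (periodic s) g → g < n → g ∣ n → ¬ Primitive s
    proper-period⇒¬primitive {g} per g<n (divides r n≡r*g) prim =
      prim (applyUpTo (periodic s) g , r , 1<r , g<n′ , tabulate-s)
      where
      1<r : 1 < r
      1<r = *-cancelʳ-< g 1 r (subst₂ _<_ (sym (*-identityˡ g)) n≡r*g g<n)
      g<n′ : length (applyUpTo (periodic s) g) < n
      g<n′ = subst (_< n) (sym (length-applyUpTo (periodic s) g)) g<n
      tabulate-s : tabulate s ≡ concat (replicate r (applyUpTo (periodic s) g))
      tabulate-s = trans (tabulate-applyUpTo s (periodic s) (λ x → cong s (sym (toℕ-mod-id x))))
        (trans (cong (applyUpTo (periodic s)) n≡r*g) (applyUpTo-period per r))

    equal-suffixes⇒¬primitive : ∀ {i j : Fin n} → toℕ i < toℕ j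
      → suffix (periodic s) (toℕ i) ≐ suffix (periodic s) (toℕ j) → ¬ Primitive s
    equal-suffixes⇒¬primitive {i} {j} i<j suffixes≐ =
      proper-period⇒¬primitive (period-gcd periodic-period per-d) g<n (gcd[m,n]∣m n d)
      where
      d : ℕ
      d = toℕ j ∸ toℕ i
      instance
        d≢0 : NonZero d
        d≢0 = >-nonZero (m<n⇒0<n∸m i<j)
      per-d : Period (periodic s) d
      per-d = equal-shifts⇒period periodic-period (<⇒≤ (toℕ<n i)) (m+[n∸m]≡n (<⇒≤ i<j)) suffixes≐
      g<n : gcd n d < n
      g<n = ≤-<-trans (gcd[m,n]≤n n d) (≤-<-trans (m∸n≤m (toℕ j) (toℕ i)) (toℕ<n j))

    primitive⇒suffix-injective : Primitive s → ∀ {i j : Fin n}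
      → suffix (periodic s) (toℕ i) ≐ suffix (periodic s) (toℕ j) → i ≡ j
    primitive⇒suffix-injective prim {i} {j} suffixes≐ with <-cmp (toℕ i) (toℕ j)
    ... | tri< i<j _ _ = ⊥-elim (equal-suffixes⇒¬primitive i<j suffixes≐ prim)
    ... | tri≈ _ i≡j _ = toℕ-injective i≡j
    ... | tri> _ _ j<i = ⊥-elim (equal-suffixes⇒¬primitive j<i (sym ∘ suffixes≐) prim)

stepwise-monotone : ∀ {k} (f : Fin (suc k) → ℕ) → (∀ t → f (inject₁ t) ≤ f (fsuc t))
  → ∀ u v → toℕ u ≤ toℕ v → f u ≤ f v
stepwise-monotone f step fzero fzero _ = ≤-refl
stepwise-monotone {suc k} f step fzero (fsuc v) _ =
  ≤-trans (step fzero) (stepwise-monotone (f ∘ fsuc) (step ∘ fsuc) fzero v z≤n)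
stepwise-monotone {suc k} f step (fsuc u) (fsuc v) (s≤s u≤v) =
  stepwise-monotone (f ∘ fsuc) (step ∘ fsuc) u v u≤v

module InducedWord {k n : ℕ} .{{_ : NonZero n}} (σ : Fin k → Sign) (π : Permutation′ n)
  (e : Fin (suc k) → ℕ) (seg : IsSegmentation σ e (hat π))
  (s : Fin n → Fin k) (induced : IsInducedWord π e s) where

  value : Fin n → ℕ
  value a = toℕ (π ⟨$⟩ʳ a)

  w : Word k
  w = periodic s

  letter<⇒value< : ∀ {a b} → toℕ (s a) < toℕ (s b) → value a < value b
  letter<⇒value< {a} {b} sa<sb = <-≤-trans (proj₂ (induced a)) (≤-trans e-between (proj₁ (induced b)))
    where
    e-between : e (fsuc (s a)) ≤ e (inject₁ (s b))
    e-between = stepwise-monotone e (proj₁ (proj₂ (proj₂ seg))) (fsuc (s a)) (inject₁ (s b))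
      (subst (suc (toℕ (s a)) ≤_) (sym (toℕ-inject₁ (s b))) sa<sb)

  value<⇒letter< : ∀ {a b} → value a < value b → s a ≢ s b → toℕ (s a) < toℕ (s b)
  value<⇒letter< {a} {b} va<vb sa≢sb with <-cmp (toℕ (s a)) (toℕ (s b))
  ... | tri< sa<sb _ _ = sa<sb
  ... | tri≈ _ sa≡sb _ = ⊥-elim (sa≢sb (toℕ-injective sa≡sb))
  ... | tri> _ _ sb<sa = ⊥-elim (<-asym va<vb (letter<⇒value< sb<sa))

  oriented-letters : ∀ c {a b} → Oriented c (value a) (value b) → s a ≢ s b
    → Oriented c (toℕ (s a)) (toℕ (s b))
  oriented-letters _ (inj₁ (even , va<vb)) sa≢sb = inj₁ (even , value<⇒letter< va<vb sa≢sb)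
  oriented-letters _ (inj₂ (odd , vb<va))  sa≢sb = inj₂ (odd , value<⇒letter< vb<va (sa≢sb ∘ sym))

  hat-step : ∀ {a b t} → s a ≡ t → s b ≡ t → value a < value b
    → Mono (σ t) (value (next a)) (value (next b))
  hat-step {a} {b} {t} sa≡t sb≡t va<vb = subst₂ (Mono (σ t)) (hat-π a) (hat-π b)
    (proj₂ (proj₂ (proj₂ seg)) t (π ⟨$⟩ʳ a) (π ⟨$⟩ʳ b)
      (subst (λ x → e (inject₁ x) ≤ value a) sa≡t (proj₁ (induced a))) va<vb
      (subst (λ x → value b < e (fsuc x)) sb≡t (proj₂ (induced b))))
    where
    hat-π : ∀ x → toℕ (hat π (π ⟨$⟩ʳ x)) ≡ value (next x)
    hat-π x = cong (λ y → toℕ (π ⟨$⟩ʳ next y)) (inverseˡ π)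

  oriented-next : ∀ c {a b} → s a ≡ s b → Oriented c (value a) (value b)
    → Oriented (c + negInd (σ (s a))) (value (next a)) (value (next b))
  oriented-next c sa≡sb o = oriented-step c _ o (hat-step refl (sym sa≡sb)) (hat-step (sym sa≡sb) refl)

  module Comparison (i j : Fin n) where

    Agree : ℕ → Set
    Agree m = ∀ l → l < m → w (toℕ i + l) ≡ w (toℕ j + l)

    count : ℕ → ℕ
    count = countNeg σ (suffix w (toℕ i))

    Invariant : ℕ → Set
    Invariant m = Agree m × Oriented (count m) (value ((toℕ i + m) mod n)) (value ((toℕ j + m) mod n))

    Less : Set
    Less = suffix w (toℕ i) ≺[ σ ] suffix w (toℕ j)

    agree-suc : ∀ {m} → Agree m → w (toℕ i + m) ≡ w (toℕ j + m) → Agree (suc m)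
    agree-suc agree eq l l<1+m with m≤n⇒m<n∨m≡n (s≤s⁻¹ l<1+m)
    ... | inj₁ l<m  = agree l l<m
    ... | inj₂ refl = eq

    invariant-zero : value i < value j → Invariant 0
    invariant-zero vi<vj = (λ _ ()) , inj₁ (refl , subst₂ _<_ (value-at i) (value-at j) vi<vj)
      where
      value-at : ∀ x → value x ≡ value ((toℕ x + 0) mod n)
      value-at x = cong value (sym (trans (cong (_mod n) (+-identityʳ (toℕ x))) (toℕ-mod-id x)))

    invariant-step : ∀ m → Invariant m → Invariant (suc m) ⊎ Less
    invariant-step m (agree , o) with s ((toℕ i + m) mod n) ≟ᶠ s ((toℕ j + m) mod n)
    ... | no  letters≢ = inj₂ (m , agree , oriented-letters (count m) o letters≢)
    ... | yes letters≡ = inj₁ (agree-suc agree letters≡ ,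
          subst₂ (Oriented (count (suc m)))
            (cong value (next-shift (toℕ i) m)) (cong value (next-shift (toℕ j) m))
            (oriented-next (count m) letters≡ o))

    invariant-or-less : value i < value j → ∀ m → Invariant m ⊎ Less
    invariant-or-less vi<vj zero = inj₁ (invariant-zero vi<vj)
    invariant-or-less vi<vj (suc m) with invariant-or-less vi<vj m
    ... | inj₁ inv  = invariant-step m inv
    ... | inj₂ less = inj₂ less

    ≐-or-≺ : value i < value j → suffix w (toℕ i) ≐ suffix w (toℕ j) ⊎ Less
    ≐-or-≺ vi<vj with invariant-or-less vi<vj n
    ... | inj₁ (agree , _) = inj₁ (≐-from-prefix (suffix-period (periodic-period s) (toℕ i))
                                                 (suffix-period (periodic-period s) (toℕ j)) agree)
    ... | inj₂ less = inj₂ less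

  open Comparison public using (≐-or-≺)

  primitive⇒pattern : Primitive s → IsPattern σ w π
  primitive⇒pattern prim i j = forward , backward
    where
    injective : ∀ {a b} → suffix w (toℕ a) ≐ suffix w (toℕ b) → a ≡ b
    injective = primitive⇒suffix-injective s prim

    forward : value i < value j → suffix w (toℕ i) ≺[ σ ] suffix w (toℕ j)
    forward vi<vj with ≐-or-≺ i j vi<vj
    ... | inj₁ suffixes≐ = ⊥-elim (<-irrefl (cong value (injective suffixes≐)) vi<vj)
    ... | inj₂ less = less

    backward : suffix w (toℕ i) ≺[ σ ] suffix w (toℕ j) → value i < value j
    backward less with <-cmp (value i) (value j)
    ... | tri< vi<vj _ _ = vi<vj
    ... | tri≈ _ vi≡vj _ = ⊥-elim (≺-irrefl (λ m → cong (λ x → w (toℕ x + m)) i≡j) less)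
      where
      i≡j : i ≡ j
      i≡j = trans (sym (inverseˡ π)) (trans (cong (π ⟨$⟩ˡ_) (toℕ-injective vi≡vj)) (inverseˡ π))
    ... | tri> _ _ vj<vi with ≐-or-≺ j i vj<vi
    ... | inj₁ suffixes≐ = ⊥-elim (≺-irrefl (sym ∘ suffixes≐) less)
    ... | inj₂ greater = ⊥-elim (≺-asym less greater)

lemma2p4 : ∀ {k n} .{{_ : NonZero n}} → 2 ≤ k → (σ : Fin k → Sign) (π : Permutation′ n)
    → (e : Fin (suc k) → ℕ) → IsSegmentation σ e (hat π)
    → (s : Fin n → Fin k) → IsInducedWord π e s
    → (∀ (i j : Fin n) → toℕ (π ⟨$⟩ʳ i) < toℕ (π ⟨$⟩ʳ j)
         → (suffix (periodic s) (toℕ i) ≐ suffix (periodic s) (toℕ j))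
           ⊎ (suffix (periodic s) (toℕ i) ≺[ σ ] suffix (periodic s) (toℕ j)))
      × (Primitive s → IsPattern σ (periodic s) π)
lemma2p4 _ σ π e seg s induced = ≐-or-≺ , primitive⇒pattern
  where open InducedWord σ π e seg s induced
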